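{- Let $V$ be a finite set of $n\ge1$ vertices with a metric $d$, let $k\ge1$ and $0\le q<n$ be integers, assume $NR_q(i)>0$ for all $i\in V$, and let $l\ge0$ be an integer. Then the output $(S,O,\sigma)$ of Algorithm 3 (described below) on input $(V,d,k,q)$ and $l$ is a feasible solution of the IF$k$CO instance $(V,d,k,q)$ with $\alpha(S,O,\sigma)\le 4\cdot OPT$, i.e. Algorithm 3 is a $4$-approximation algorithm for the IF$k$CO.
   Context: A metric $d$ on $V$ satisfies $d_{ij}\ge0$, $d_{ii}=0$, $d_{ij}=d_{ji}$ and $d_{hi}+d_{ij}\ge d_{hj}$. For $i\in V$, $NR_q(i)$ is the distance from $i$ to its $\lceil (n-q)/k\rceil$-th nearest neighbour in $V$ ($i$ counts as its own first nearest neighbour). In the individually fair $k$-center with outliers (IF$k$CO), a solution is a triple $(S,O,\sigma)$ with $S\subseteq V$ (centers), $O\subseteq V$ (outliers), $\sigma:V\setminus O\to S$; it is feasible if $|S|\le k$ and $|O|\le q$. Its outlier-related fairness ratio is $\alpha(S,O,\sigma)=\max_{i\in V\setminus O} d_{\sigma(i)i}/NR_q(i)$, and $OPT$ is the minimum of $\alpha$ over all feasible solutions. For a real $\beta>0$, the procedure $G(\beta)$ is: start with $P:=V$, $S:=\emptyset$; while $P\neq\emptyset$ and $|S|<k$, choose $s\in P$ with $s\in\arg\min_{i\in P} NR_q(i)$ (ties arbitrary), set $S:=S\cup\{s\}$ and $P:=\{i\in P: d_{is}>\beta\,NR_q(i)\}$; finally output $(S,O,\sigma)$ with $O:=P$ and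 $\sigma(i)\in\arg\min_{h\in S}d_{ih}$ for $i\in V\setminus O$. Algorithm 2 is $G(2)$. Algorithm 3 (input $(V,d,k,q)$ and $l$): let the current solution be the output of Algorithm 2; set $t:=0$, $\beta_1:=1$, $\beta_2:=2$, $\beta:=1$. While $t<l$: compute $(S_\beta,O_\beta,\sigma_\beta):=G(\beta)$; if $|O_\beta|>q$, set $\beta_1:=\beta$; otherwise replace the current solution by $(S_\beta,O_\beta,\sigma_\beta)$ and set $\beta_2:=\beta$; in either case then set $\beta:=(\beta_1+\beta_2)/2$ and $t:=t+1$. Output the current solution.
   Formalization: The metric $d$ takes only rational values. -}

module Defs where

open import Data.Nat as ℕ using (ℕ; zero; suc; _∸_)
open import Data.Nat.DivMod using (_/_)
open import Data.Integer using (+_; +[1+_]; -[1+_])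
open import Data.Rational as ℚ using (ℚ; mkℚ; 0ℚ; 1ℚ; ½; _÷_)
open import Data.Rational.Properties using (≤-decTotalOrder; _<?_)
open import Data.Fin using (Fin)
open import Data.Fin.Subset using (Subset; _∈_; _∉_; ∣_∣; _∪_; ⁅_⁆; ⊥; ⊤; Empty)
open import Data.Vec using (tabulate; lookup)
open import Data.Bool using (_∧_)
open import Data.List using (List; []; _∷_; map; foldr)
open import Data.List.Sort ≤-decTotalOrder using (sort)
open import Data.Product using (_×_; Σ; ∃; _,_)
open import Data.Sum using (_⊎_)
open import Relation.Nullary.Decidable using (⌊_⌋)
open import Relation.Binary.PropositionalEquality using (_≡_)
open import Relation.Nullary using (¬_; Dec; yes; no)
import Data.List as L

2ℚ : ℚ
2ℚ = 1ℚ ℚ.+ 1ℚ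

4ℚ : ℚ
4ℚ = 2ℚ ℚ.+ 2ℚ

-- total division on ℚ: x ÷ y for y ≠ 0, and 0 when y = 0 (never used
-- under the hypothesis NR_q(i) > 0)
_÷?_ : ℚ → ℚ → ℚ
x ÷? mkℚ (+ zero) _ _ = 0ℚ
x ÷? y@(mkℚ +[1+ _ ] _ _) = x ÷ y
x ÷? y@(mkℚ -[1+ _ ] _ _) = x ÷ y

-- ceiling division ⌈ a / k ⌉ (k = 0 gives 0; not used since k ≥ 1)
⌈_/_⌉ : ℕ → ℕ → ℕ
⌈ a / zero ⌉ = 0
⌈ a / suc k ⌉ = (a ℕ.+ k) / suc k

-- m-th element (1-indexed) of a list, default 0
nth : List ℚ → ℕ → ℚ
nth [] _ = 0ℚ
nth (x ∷ xs) zero = 0ℚ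
nth (x ∷ xs) (suc zero) = x
nth (x ∷ xs) (suc (suc m)) = nth xs (suc m)

Dist : ℕ → Set
Dist n = Fin n → Fin n → ℚ

IsMetric : ∀ {n} → Dist n → Set
IsMetric {n} d =
  (∀ i j → 0ℚ ℚ.≤ d i j) ×
  (∀ i → d i i ≡ 0ℚ) ×
  (∀ i j → d i j ≡ d j i) ×
  (∀ h i j → d h j ℚ.≤ d h i ℚ.+ d i j)

-- NR_q(i): distance from i to its ⌈(n-q)/k⌉-th nearest neighbour in V
-- (i is its own first nearest neighbour): the ⌈(n-q)/k⌉-th smallest
-- entry (with multiplicity) of the list of distances d i j, j ∈ V.
NR : ∀ {n} → Dist n → (k q : ℕ) → Fin n → ℚ
NR {n} d k q i = nth (sort (map (d i) (Data.List.allFin n))) ⌈ (n ∸ q) / k ⌉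
  where import Data.List

-- A solution (S, O, σ). σ is given as a total map Fin n → Fin n; only its
-- values on V ∖ O matter (it is required to map V ∖ O into S).
record Solution (n : ℕ) : Set where
  constructor sol
  field
    S : Subset n
    O : Subset n
    σ : Fin n → Fin n
open Solution public

Feasible : ∀ {n} → (k q : ℕ) → Solution n → Set
Feasible k q s =
  ∣ S s ∣ ℕ.≤ k × ∣ O s ∣ ℕ.≤ q × (∀ i → i ∉ O s → σ s i ∈ S s)

-- maximum of a list of rationals (all values considered here are ≥ 0;
-- the empty maximum is 0)
maxℚ : List ℚ → ℚ
maxℚ = foldr ℚ._⊔_ 0ℚ

inO? : ∀ {n} (O : Subset n) (i : Fin n) → Dec (i ∈ O)
inO? O i = Data.Fin.Subset.Properties._∈?_ i O
  where import Data.Fin.Subset.Properties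

α : ∀ {n} → Dist n → (k q : ℕ) → Solution n → ℚ
α {n} d k q s =
  maxℚ (L.map (λ i → d (σ s i) i ÷? NR d k q i)
              (L.filter (λ i → Relation.Nullary.Decidable.¬? (inO? (O s) i))
                        (L.allFin n)))

keep : ∀ {n} → Dist n → (k q : ℕ) → ℚ → Fin n → Subset n → Subset n
keep d k q β s P =
  tabulate (λ i → lookup P i ∧ ⌊ (β ℚ.* NR d k q i) <? d i s ⌋)

-- Runs of the while loop of G(β) (ties in the argmin are arbitrary):
-- GLoop d k q β P S S' O'  means: starting from state (P, S) the loop can
-- terminate with centers S' and remaining set P = O'.
data GLoop {n} (d : Dist n) (k q : ℕ) (β : ℚ)
     : Subset n → Subset n → Subset n → Subset n → Set where
  stop : ∀ {P S} → (Empty P ⊎ k ℕ.≤ ∣ S ∣) → GLoop d k q β P S S P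
  step : ∀ {P S S' O'} (s : Fin n) → s ∈ P → ∣ S ∣ ℕ.< k →
         (∀ i → i ∈ P → NR d k q s ℚ.≤ NR d k q i) →
         GLoop d k q β (keep d k q β s P) (S ∪ ⁅ s ⁆) S' O' →
         GLoop d k q β P S S' O'

-- sol is a possible output of G(β): a loop run from P = V, S = ∅, O := P,
-- and σ(i) ∈ argmin_{h ∈ S} d_{ih} for i ∈ V ∖ O.
GOut : ∀ {n} → Dist n → (k q : ℕ) → ℚ → Solution n → Set
GOut d k q β s =
  GLoop d k q β ⊤ ⊥ (S s) (O s) ×
  (∀ i → i ∉ O s → σ s i ∈ S s × (∀ h → h ∈ S s → d i (σ s i) ℚ.≤ d i h))

-- The bisection loop of Algorithm 3.  Alg3Loop d k q β₁ β₂ β cur r out: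
-- with r iterations remaining, state (β₁, β₂, β) and current solution cur,
-- the loop can end with output out.
data Alg3Loop {n} (d : Dist n) (k q : ℕ)
     : ℚ → ℚ → ℚ → Solution n → ℕ → Solution n → Set where
  done : ∀ {β₁ β₂ β cur} → Alg3Loop d k q β₁ β₂ β cur 0 cur
  fail : ∀ {β₁ β₂ β cur r out} (s : Solution n) → GOut d k q β s →
         q ℕ.< ∣ O s ∣ →
         Alg3Loop d k q β β₂ ((β ℚ.+ β₂) ℚ.* ½) cur r out →
         Alg3Loop d k q β₁ β₂ β cur (suc r) out
  succ : ∀ {β₁ β₂ β cur r out} (s : Solution n) → GOut d k q β s →
         ∣ O s ∣ ℕ.≤ q →
         Alg3Loop d k q β₁ β ((β₁ ℚ.+ β) ℚ.* ½) s r out →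
         Alg3Loop d k q β₁ β₂ β cur (suc r) out

-- out is a possible output of Algorithm 3 with parameter l:
-- initial solution = output of Algorithm 2 = G(2); t := 0, β₁ := 1,
-- β₂ := 2, β := 1; loop l times.
Alg3 : ∀ {n} → Dist n → (k q l : ℕ) → Solution n → Set
Alg3 d k q l out =
  Σ (Solution _) λ s₀ → GOut d k q 2ℚ s₀ × Alg3Loop d k q 1ℚ 2ℚ 1ℚ s₀ l out

-- G(β) serves every non-outlier i from a centre within β · NR_q(i), so any output of G(β) has
-- α ≤ β.  For β = 2 the balls B(s, NR_q(s)) around the chosen centres are pairwise disjoint,
-- disjoint from the set P still to be served, and each contains at least m = ⌈(n − q)/k⌉ points;
-- so once k centres are chosen at most n − km ≤ q points are left, and G(2) has at most q
-- outliers.  Algorithm 3 only replaces its solution by an output of some G(β), β ≤ 2, with at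
-- most q outliers, hence outputs a feasible solution with α ≤ 2.  Conversely, in a feasible
-- solution the ≥ n − q served vertices use at most k centres, so some centre c serves at least
-- m of them; if j is the one farthest from c, all of them lie within 2 d(c, j) of j, whence
-- NR_q(j) ≤ 2 d(c, j) and OPT ≥ ½.
module Submission where

open import Defs
open import Data.Nat using (ℕ; _≤_; _<_)
open import Data.Rational using (ℚ; 0ℚ) renaming (_<_ to _<ℚ_; _≤_ to _≤ℚ_; _*_ to _*ℚ_)
open import Data.Fin using (Fin)
open import Data.Product using (_×_; ∃)

open import Data.Bool using (Bool; T)
open import Data.Bool.Properties using (T-∧; T-≡)
open import Data.Nat using (zero; suc; z≤n; s≤s; _+_; _*_; _∸_; _<?_; >-nonZero)
open import Data.Nat.Properties as ℕ using (module ≤-Reasoning)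
open import Data.Nat.DivMod using (_/_; _%_; m≡m%n+[m/n]*n; m%n<n; m/n*n≤m; m≥n⇒m/n>0)
open import Data.Nat.Induction using (<-wellFounded)
open import Data.Integer as ℤ using (+[1+_]; -[1+_]; +<+; +≤+)
open import Data.Rational using (1ℚ; ½; mkℚ; 1/_; *<*; *≤*; positive; nonNegative) renaming (_+_ to _+ℚ_)
open import Data.Rational.Properties as ℚ using (_≤?_)
open import Data.Fin using (zero; suc; _≟_)
open import Data.Fin.Properties using (any?)
open import Data.Fin.Subset
  using (Subset; inside; outside; _∈_; _∉_; _⊆_; ∣_∣; _∪_; _∩_; _─_; _-_; ⁅_⁆; ∁; ⊤; ⊥; Empty; Nonempty)
open import Data.Fin.Subset.Properties
  using ( ∈⊤; ∉⊥; ∣⊥∣≡0; ∣p∣≤n; ∣⁅x⁆∣≡1; Empty-unique; nonempty?; _∈?_; p⊆q⇒∣p∣≤∣q∣; p⊂q⇒∣p∣<∣q∣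
        ; x∈p∪q⁺; x∈p∪q⁻; x∈p∩q⁺; x∈p∩q⁻; x∈⁅x⁆; x∈p∧x≢y⇒x∈p-y
        ; p─q⊆p; x∈p⇒∣p-x∣<∣p∣; x∈∁p⇒x∉p; ∣∁p∣≡n∸∣p∣ )
open import Data.Vec using ([]; _∷_; here; there; tabulate; lookup)
open import Data.Vec.Properties using (lookup∘tabulate; []=⇒lookup; lookup⇒[]=)
open import Data.List using (List; []; _∷_; map; filter; length; allFin)
open import Data.List.Properties
  using (map-tabulate; length-map; length-tabulate; filter-none; filter-accept; filter-reject)
open import Data.List.Membership.Propositional using () renaming (_∈_ to _∈ˡ_)
open import Data.List.Membership.Propositional.Properties using (∈-filter⁺; ∈-filter⁻; ∈-allFin)
open import Data.List.Relation.Unary.Any using (here; there)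
open import Data.List.Relation.Unary.All as All using (All)
open import Data.List.Relation.Unary.Linked using (_∷_; tail)
open import Data.List.Relation.Unary.Linked.Properties using (Linked⇒All)
open import Data.List.Relation.Binary.Permutation.Propositional.Properties using (↭-length; filter-↭)
open import Data.List.Sort ℚ.≤-decTotalOrder using (sort; sort-↭; sort-↗)
open import Data.Product using (_,_; proj₁; proj₂; ∃₂)
open import Data.Sum using (_⊎_; inj₁; inj₂)
open import Function using (_∘_; Equivalence)
open import Induction.WellFounded using (Acc; acc)
open import Level using (0ℓ)
open import Relation.Binary.Bundles using (TotalOrder; DecTotalOrder)
import Relation.Binary.Properties.TotalOrder as TotalOrderProperties
open import Relation.Binary.PropositionalEquality
  using (_≡_; refl; sym; trans; cong; cong₂; subst; module ≡-Reasoning)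
open import Relation.Nullary using (¬_; yes; no; contradiction)
open import Relation.Nullary.Decidable using (⌊_⌋; toWitness; fromWitness; ¬?)

ℚ-≤-totalOrder : TotalOrder 0ℓ 0ℓ 0ℓ
ℚ-≤-totalOrder = DecTotalOrder.totalOrder ℚ.≤-decTotalOrder

open import Data.List.Relation.Unary.Sorted.TotalOrder ℚ-≤-totalOrder using (Sorted)

-- Finite subsets

∈⇒T-lookup : ∀ {n} {p : Subset n} {i} → i ∈ p → T (lookup p i)
∈⇒T-lookup i∈p = subst T (sym ([]=⇒lookup i∈p)) _

T-lookup⇒∈ : ∀ {n} {p : Subset n} {i} → T (lookup p i) → i ∈ p
T-lookup⇒∈ {p = p} {i} t = lookup⇒[]= i p (Equivalence.to T-≡ t)

∈-tabulate⁻ : ∀ {n} {f : Fin n → Bool} {i} → i ∈ tabulate f → T (f i)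
∈-tabulate⁻ {f = f} {i} = subst T (lookup∘tabulate f i) ∘ ∈⇒T-lookup

∈-tabulate⁺ : ∀ {n} {f : Fin n → Bool} {i} → T (f i) → i ∈ tabulate f
∈-tabulate⁺ {f = f} {i} = T-lookup⇒∈ ∘ subst T (sym (lookup∘tabulate f i))

x∈p─q⇒x∉q : ∀ {n} (p q : Subset n) {x} → x ∈ p ─ q → x ∉ q
x∈p─q⇒x∉q (_ ∷ p) (outside ∷ q) (there x∈p─q) (there x∈q) = x∈p─q⇒x∉q p q x∈p─q x∈q
x∈p─q⇒x∉q (_ ∷ p) (inside  ∷ q) (there x∈p─q) (there x∈q) = x∈p─q⇒x∉q p q x∈p─q x∈q
x∈p─q⇒x∉q (inside ∷ p) (outside ∷ q) here ()

∣p∪q∣≤∣p∣+∣q∣ : ∀ {n} (p q : Subset n) → ∣ p ∪ q ∣ ≤ ∣ p ∣ + ∣ q ∣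
∣p∪q∣≤∣p∣+∣q∣ []            []            = z≤n
∣p∪q∣≤∣p∣+∣q∣ (inside  ∷ p) (inside  ∷ q) =
  s≤s (ℕ.≤-trans (∣p∪q∣≤∣p∣+∣q∣ p q) (ℕ.+-monoʳ-≤ ∣ p ∣ (ℕ.n≤1+n ∣ q ∣)))
∣p∪q∣≤∣p∣+∣q∣ (inside  ∷ p) (outside ∷ q) = s≤s (∣p∪q∣≤∣p∣+∣q∣ p q)
∣p∪q∣≤∣p∣+∣q∣ (outside ∷ p) (inside  ∷ q) =
  subst (suc ∣ p ∪ q ∣ ≤_) (sym (ℕ.+-suc ∣ p ∣ ∣ q ∣)) (s≤s (∣p∪q∣≤∣p∣+∣q∣ p q))
∣p∪q∣≤∣p∣+∣q∣ (outside ∷ p) (outside ∷ q) = ∣p∪q∣≤∣p∣+∣q∣ p q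

∣p∣+∣q∣≤∣p∪q∣ : ∀ {n} (p q : Subset n) → (∀ {x} → x ∈ p → x ∉ q) → ∣ p ∣ + ∣ q ∣ ≤ ∣ p ∪ q ∣
∣p∣+∣q∣≤∣p∪q∣ []            []            _        = z≤n
∣p∣+∣q∣≤∣p∪q∣ (inside  ∷ p) (inside  ∷ q) disjoint = contradiction here (disjoint here)
∣p∣+∣q∣≤∣p∪q∣ (inside  ∷ p) (outside ∷ q) disjoint = s≤s (∣p∣+∣q∣≤∣p∪q∣ p q (λ x∈p → disjoint (there x∈p) ∘ there))
∣p∣+∣q∣≤∣p∪q∣ (outside ∷ p) (inside  ∷ q) disjoint =
  subst (_≤ suc ∣ p ∪ q ∣) (sym (ℕ.+-suc ∣ p ∣ ∣ q ∣)) (s≤s (∣p∣+∣q∣≤∣p∪q∣ p q (λ x∈p → disjoint (there x∈p) ∘ there)))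
∣p∣+∣q∣≤∣p∪q∣ (outside ∷ p) (outside ∷ q) disjoint = ∣p∣+∣q∣≤∣p∪q∣ p q (λ x∈p → disjoint (there x∈p) ∘ there)

∣p∣≡∣p∩q∣+∣p─q∣ : ∀ {n} (p q : Subset n) → ∣ p ∣ ≡ ∣ p ∩ q ∣ + ∣ p ─ q ∣
∣p∣≡∣p∩q∣+∣p─q∣ []            []            = refl
∣p∣≡∣p∩q∣+∣p─q∣ (inside  ∷ p) (inside  ∷ q) = cong suc (∣p∣≡∣p∩q∣+∣p─q∣ p q)
∣p∣≡∣p∩q∣+∣p─q∣ (inside  ∷ p) (outside ∷ q) = trans (cong suc (∣p∣≡∣p∩q∣+∣p─q∣ p q)) (sym (ℕ.+-suc _ _))
∣p∣≡∣p∩q∣+∣p─q∣ (outside ∷ p) (inside  ∷ q) = ∣p∣≡∣p∩q∣+∣p─q∣ p q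
∣p∣≡∣p∩q∣+∣p─q∣ (outside ∷ p) (outside ∷ q) = ∣p∣≡∣p∩q∣+∣p─q∣ p q

∣p∪⁅x⁆∣≤1+∣p∣ : ∀ {n} (p : Subset n) x → ∣ p ∪ ⁅ x ⁆ ∣ ≤ suc ∣ p ∣
∣p∪⁅x⁆∣≤1+∣p∣ p x =
  ℕ.≤-trans (∣p∪q∣≤∣p∣+∣q∣ p ⁅ x ⁆) (ℕ.≤-reflexive (trans (cong (∣ p ∣ +_) (∣⁅x⁆∣≡1 x)) (ℕ.+-comm ∣ p ∣ 1)))

preimage : ∀ {m n} → (Fin m → Fin n) → Fin n → Subset m
preimage f c = tabulate (λ j → ⌊ f j ≟ c ⌋)

∈-preimage⁻ : ∀ {m n} {f : Fin m → Fin n} {c j} → j ∈ preimage f c → f j ≡ c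
∈-preimage⁻ = toWitness ∘ ∈-tabulate⁻

∈-preimage⁺ : ∀ {m n} {f : Fin m → Fin n} {c j} → f j ≡ c → j ∈ preimage f c
∈-preimage⁺ = ∈-tabulate⁺ ∘ fromWitness

∩-monoˡ : ∀ {n} {p q : Subset n} (r : Subset n) → p ⊆ q → p ∩ r ⊆ q ∩ r
∩-monoˡ r p⊆q x∈p∩r = let x∈p , x∈r = x∈p∩q⁻ _ r x∈p∩r in x∈p∩q⁺ (p⊆q x∈p , x∈r)

∣A∣≤∣C∣*b : ∀ {m n b} (f : Fin m → Fin n) (A : Subset m) (C : Subset n) →
            (∀ {j} → j ∈ A → f j ∈ C) → (∀ c → ∣ A ∩ preimage f c ∣ ≤ b) → ∣ A ∣ ≤ ∣ C ∣ * b
∣A∣≤∣C∣*b {m} {b = b} f A C f[A]⊆C fibre≤b = go A C (λ x → x) f[A]⊆C (<-wellFounded ∣ C ∣)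
  where
  open ≤-Reasoning
  go : ∀ B C → B ⊆ A → (∀ {j} → j ∈ B → f j ∈ C) → Acc _<_ ∣ C ∣ → ∣ B ∣ ≤ ∣ C ∣ * b
  go B C B⊆A maps (acc smaller) with nonempty? C
  ... | no C-empty = begin
    ∣ B ∣     ≡⟨ cong ∣_∣ (Empty-unique (λ (j , j∈B) → C-empty (f j , maps j∈B))) ⟩
    ∣ ⊥ {m} ∣ ≡⟨ ∣⊥∣≡0 m ⟩
    0         ≤⟨ z≤n ⟩
    ∣ C ∣ * b ∎
  ... | yes (c , c∈C) = begin
    ∣ B ∣                                      ≡⟨ ∣p∣≡∣p∩q∣+∣p─q∣ B (preimage f c) ⟩
    ∣ B ∩ preimage f c ∣ + ∣ B ─ preimage f c ∣ ≤⟨ ℕ.+-mono-≤ fibre≤b′ rest≤ ⟩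
    b + ∣ C - c ∣ * b                          ≤⟨ ℕ.*-monoˡ-≤ b (x∈p⇒∣p-x∣<∣p∣ c∈C) ⟩
    ∣ C ∣ * b                                  ∎
    where
    fibre≤b′ : ∣ B ∩ preimage f c ∣ ≤ b
    fibre≤b′ = ℕ.≤-trans (p⊆q⇒∣p∣≤∣q∣ (∩-monoˡ (preimage f c) B⊆A)) (fibre≤b c)
    maps′ : ∀ {j} → j ∈ B ─ preimage f c → f j ∈ C - c
    maps′ {j} j∈ = x∈p∧x≢y⇒x∈p-y (maps (p─q⊆p B _ j∈)) (x∈p─q⇒x∉q B _ j∈ ∘ ∈-preimage⁺)
    rest≤ : ∣ B ─ preimage f c ∣ ≤ ∣ C - c ∣ * b
    rest≤ = go (B ─ preimage f c) (C - c) (B⊆A ∘ p─q⊆p B _) maps′ (smaller (x∈p⇒∣p-x∣<∣p∣ c∈C))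

pigeonhole-preimage : ∀ {m n b} (f : Fin m → Fin n) (A : Subset m) (C : Subset n) →
                      (∀ {j} → j ∈ A → f j ∈ C) → ∣ C ∣ * b < ∣ A ∣ → ∃ λ c → b < ∣ A ∩ preimage f c ∣
pigeonhole-preimage {b = b} f A C f[A]⊆C large with any? (λ c → b <? ∣ A ∩ preimage f c ∣)
... | yes found = found
... | no none   = contradiction (∣A∣≤∣C∣*b f A C f[A]⊆C (λ c → ℕ.≮⇒≥ (none ∘ (c ,_)))) (ℕ.<⇒≱ large)

module _ {a ℓ₁ ℓ₂} (order : TotalOrder a ℓ₁ ℓ₂) where
  open TotalOrder order using (total) renaming (Carrier to A; _≤_ to _≼_; refl to ≼-refl; trans to ≼-trans)

  argmin : ∀ {n} (p : Subset n) (f : Fin n → A) →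
           Empty p ⊎ ∃ λ s → s ∈ p × ∀ {i} → i ∈ p → f s ≼ f i
  argmin []      f = inj₁ λ ()
  argmin (b ∷ p) f with argmin p (f ∘ suc)
  argmin (outside ∷ p) f | inj₁ empty = inj₁ λ { (suc i , there i∈p) → empty (i , i∈p) }
  argmin (inside  ∷ p) f | inj₁ empty =
    inj₂ (zero , here , λ { here → ≼-refl ; (there i∈p) → contradiction (_ , i∈p) empty })
  argmin (outside ∷ p) f | inj₂ (s , s∈p , min) = inj₂ (suc s , there s∈p , λ { (there i∈p) → min i∈p })
  argmin (inside  ∷ p) f | inj₂ (s , s∈p , min) with total (f zero) (f (suc s))
  ... | inj₁ f0≼fs = inj₂ (zero , here , λ { here → ≼-refl ; (there i∈p) → ≼-trans f0≼fs (min i∈p) })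
  ... | inj₂ fs≼f0 = inj₂ (suc s , there s∈p , λ { here → fs≼f0 ; (there i∈p) → min i∈p })

-- Ceiling division

a≤k*⌈a/k⌉ : ∀ a {k} → 0 < k → a ≤ k * ⌈ a / k ⌉
a≤k*⌈a/k⌉ a {suc k} _ = ℕ.+-cancelʳ-≤ k a _ (begin
  a + k                                    ≡⟨ m≡m%n+[m/n]*n (a + k) (suc k) ⟩
  (a + k) % suc k + ⌈ a / suc k ⌉ * suc k   ≤⟨ ℕ.+-monoˡ-≤ _ (ℕ.≤-pred (m%n<n (a + k) (suc k))) ⟩
  k + ⌈ a / suc k ⌉ * suc k                 ≡⟨ ℕ.+-comm k _ ⟩
  ⌈ a / suc k ⌉ * suc k + k                 ≡⟨ cong (_+ k) (ℕ.*-comm ⌈ a / suc k ⌉ (suc k)) ⟩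
  suc k * ⌈ a / suc k ⌉ + k                 ∎)
  where open ≤-Reasoning

k*[⌈a/k⌉∸1]<a : ∀ a {k} → 0 < k → 0 < a → k * (⌈ a / k ⌉ ∸ 1) < a
k*[⌈a/k⌉∸1]<a a@(suc a′) {suc k} _ _ = begin-strict
  suc k * (⌈ a / suc k ⌉ ∸ 1)        ≡⟨ ℕ.*-comm (suc k) _ ⟩
  (⌈ a / suc k ⌉ ∸ 1) * suc k        ≡⟨ ℕ.*-distribʳ-∸ (suc k) ⌈ a / suc k ⌉ 1 ⟩
  ⌈ a / suc k ⌉ * suc k ∸ 1 * suc k   ≤⟨ ℕ.∸-monoˡ-≤ (1 * suc k) (m/n*n≤m (a + k) (suc k)) ⟩
  a + k ∸ 1 * suc k                  ≡⟨ cong (a + k ∸_) (ℕ.*-identityˡ (suc k)) ⟩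
  a′ + k ∸ k                         ≡⟨ ℕ.m+n∸n≡m a′ k ⟩
  a′                                 <⟨ ℕ.n<1+n a′ ⟩
  a                                  ∎
  where open ≤-Reasoning

⌈a/k⌉≤a : ∀ a {k} → 0 < k → 0 < a → ⌈ a / k ⌉ ≤ a
⌈a/k⌉≤a a {k} 0<k 0<a = begin
  ⌈ a / k ⌉                   ≤⟨ ℕ.m≤n+m∸n ⌈ a / k ⌉ 1 ⟩
  suc (⌈ a / k ⌉ ∸ 1)         ≤⟨ s≤s (ℕ.m≤n*m (⌈ a / k ⌉ ∸ 1) k {{>-nonZero 0<k}}) ⟩
  suc (k * (⌈ a / k ⌉ ∸ 1))   ≤⟨ k*[⌈a/k⌉∸1]<a a 0<k 0<a ⟩
  a                           ∎
  where open ≤-Reasoning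

⌈a/k⌉>0 : ∀ a {k} → 0 < k → 0 < a → 0 < ⌈ a / k ⌉
⌈a/k⌉>0 a {suc k} _ 0<a = m≥n⇒m/n>0 (ℕ.+-monoˡ-≤ k 0<a)

-- Order statistics of sorted lists and balls

count≤ : ℚ → List ℚ → ℕ
count≤ v xs = length (filter (_≤? v) xs)

count≤-accept : ∀ {v x} xs → x ≤ℚ v → count≤ v (x ∷ xs) ≡ suc (count≤ v xs)
count≤-accept _ x≤v = cong length (filter-accept (_≤? _) x≤v)

count≤-reject : ∀ {v x} xs → ¬ x ≤ℚ v → count≤ v (x ∷ xs) ≡ count≤ v xs
count≤-reject _ x≰v = cong length (filter-reject (_≤? _) x≰v)

head≤nth : ∀ {x xs m} → Sorted (x ∷ xs) → m ≤ length xs → x ≤ℚ nth (x ∷ xs) (suc m)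
head≤nth {m = zero}               _              _        = ℚ.≤-refl
head≤nth {xs = _ ∷ _} {m = suc _} (x≤y ∷ sorted) (s≤s m≤) = ℚ.≤-trans x≤y (head≤nth sorted m≤)

nth≤⇒≤count≤ : ∀ {xs m v} → Sorted xs → 0 < m → m ≤ length xs → nth xs m ≤ℚ v → m ≤ count≤ v xs
nth≤⇒≤count≤ {x ∷ xs} {suc m} {v} sorted _ (s≤s m≤) nth≤v =
  subst (suc m ≤_) (sym (count≤-accept xs x≤v)) (s≤s (rest m m≤ nth≤v))
  where
  x≤v : x ≤ℚ v
  x≤v = ℚ.≤-trans (head≤nth sorted m≤) nth≤v
  rest : ∀ m → m ≤ length xs → nth (x ∷ xs) (suc m) ≤ℚ v → m ≤ count≤ v xs
  rest zero    _  _     = z≤n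
  rest (suc m) m≤ nth≤v = nth≤⇒≤count≤ (tail sorted) (s≤s z≤n) m≤ nth≤v

count≤⇒nth≤ : ∀ {xs m v} → Sorted xs → 0 < m → m ≤ count≤ v xs → nth xs m ≤ℚ v
count≤⇒nth≤ {[]}     _ 0<m m≤ = contradiction m≤ (ℕ.<⇒≱ 0<m)
count≤⇒nth≤ {x ∷ xs} {m} {v} sorted 0<m m≤ with x ≤? v
... | no x≰v = contradiction m≤0 (ℕ.<⇒≱ 0<m)
  where
  beyond-v : All (λ y → ¬ y ≤ℚ v) xs
  beyond-v = All.map (λ x≤y y≤v → x≰v (ℚ.≤-trans x≤y y≤v)) (All.tail (Linked⇒All ℚ.≤-trans ℚ.≤-refl sorted))
  m≤0 : m ≤ 0
  m≤0 = subst (m ≤_) (trans (count≤-reject xs x≰v) (cong length (filter-none (_≤? v) beyond-v))) m≤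
count≤⇒nth≤ {x ∷ xs} {suc zero}    _      _ _  | yes x≤v = x≤v
count≤⇒nth≤ {x ∷ xs} {suc (suc m)} sorted _ m≤ | yes x≤v =
  count≤⇒nth≤ (tail sorted) (s≤s z≤n) (ℕ.≤-pred (subst (suc (suc m) ≤_) (count≤-accept xs x≤v) m≤))

count≤-tabulate : ∀ {n} (g : Fin n → ℚ) v →
                  count≤ v (Data.List.tabulate g) ≡ ∣ tabulate (λ j → ⌊ g j ≤? v ⌋) ∣
count≤-tabulate {zero}  g v = refl
count≤-tabulate {suc n} g v = cons (count≤-tabulate (g ∘ suc) v)
  where
  -- The first entries are unfolded so that `with` can abstract over g zero ≤? v on both sides.
  cons : count≤ v (Data.List.tabulate (g ∘ suc)) ≡ ∣ tabulate (λ j → ⌊ g (suc j) ≤? v ⌋) ∣ →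
         count≤ v (g zero ∷ Data.List.tabulate (g ∘ suc)) ≡ ∣ ⌊ g zero ≤? v ⌋ ∷ tabulate (λ j → ⌊ g (suc j) ≤? v ⌋) ∣
  cons ih with g zero ≤? v
  ... | yes g0≤v = trans (count≤-accept _ g0≤v) (cong suc ih)
  ... | no  g0≰v = trans (count≤-reject _ g0≰v) ih

module _ {n} (d : Dist n) where

  ball : Fin n → ℚ → Subset n
  ball i r = tabulate (λ j → ⌊ d i j ≤? r ⌋)

  ∈-ball⁺ : ∀ {i j r} → d i j ≤ℚ r → j ∈ ball i r
  ∈-ball⁺ = ∈-tabulate⁺ ∘ fromWitness

  ∈-ball⁻ : ∀ {i j r} → j ∈ ball i r → d i j ≤ℚ r
  ∈-ball⁻ = toWitness ∘ ∈-tabulate⁻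

  distances : Fin n → List ℚ
  distances i = sort (map (d i) (allFin n))

  length-distances : ∀ i → length (distances i) ≡ n
  length-distances i =
    trans (↭-length (sort-↭ _)) (trans (length-map (d i) (allFin n)) (length-tabulate (λ j → j)))

  count≤-distances : ∀ i r → count≤ r (distances i) ≡ ∣ ball i r ∣
  count≤-distances i r = begin
    count≤ r (distances i)                      ≡⟨ ↭-length (filter-↭ (_≤? r) (sort-↭ _)) ⟩
    count≤ r (map (d i) (allFin n))             ≡⟨ cong (count≤ r) (map-tabulate (λ j → j) (d i)) ⟩
    count≤ r (Data.List.tabulate (d i))          ≡⟨ count≤-tabulate (d i) r ⟩
    ∣ ball i r ∣                                ∎
    where open ≡-Reasoning

  m≤∣ball-nth∣ : ∀ {i m} → 0 < m → m ≤ n → m ≤ ∣ ball i (nth (distances i) m) ∣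
  m≤∣ball-nth∣ {i} {m} 0<m m≤n =
    subst (m ≤_) (count≤-distances i _)
          (nth≤⇒≤count≤ (sort-↗ _) 0<m (subst (m ≤_) (sym (length-distances i)) m≤n) ℚ.≤-refl)

  m≤∣ball∣⇒nth≤r : ∀ {i m r} → 0 < m → m ≤ ∣ ball i r ∣ → nth (distances i) m ≤ℚ r
  m≤∣ball∣⇒nth≤r {i} {m} {r} 0<m m≤ =
    count≤⇒nth≤ (sort-↗ _) 0<m (subst (m ≤_) (sym (count≤-distances i r)) m≤)

-- Rational arithmetic

[p+p]*½≡p : ∀ p → (p +ℚ p) *ℚ ½ ≡ p
[p+p]*½≡p p = begin
  (p +ℚ p) *ℚ ½        ≡⟨ ℚ.*-distribʳ-+ ½ p p ⟩
  p *ℚ ½ +ℚ p *ℚ ½     ≡⟨ ℚ.*-distribˡ-+ p ½ ½ ⟨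
  p *ℚ (½ +ℚ ½)        ≡⟨ ℚ.*-identityʳ p ⟩
  p                    ∎
  where open ≡-Reasoning

midpoint-between : ∀ {l u x y} → l ≤ℚ x → x ≤ℚ u → l ≤ℚ y → y ≤ℚ u →
                   l ≤ℚ (x +ℚ y) *ℚ ½ × (x +ℚ y) *ℚ ½ ≤ℚ u
midpoint-between {l} {u} l≤x x≤u l≤y y≤u =
  subst (_≤ℚ _) ([p+p]*½≡p l) (ℚ.*-monoʳ-≤-nonNeg ½ (ℚ.+-mono-≤ l≤x l≤y)) ,
  subst (_ ≤ℚ_) ([p+p]*½≡p u) (ℚ.*-monoʳ-≤-nonNeg ½ (ℚ.+-mono-≤ x≤u y≤u))

÷?-*-cancel : ∀ a {N} → 0ℚ <ℚ N → (a ÷? N) *ℚ N ≡ a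
÷?-*-cancel a {mkℚ (ℤ.+ zero) _ _} (*<* (+<+ ()))
÷?-*-cancel a {mkℚ -[1+ _ ]   _ _} (*<* ())
÷?-*-cancel a {N@(mkℚ +[1+ _ ] _ _)} _ = begin
  (a *ℚ 1/ N) *ℚ N    ≡⟨ ℚ.*-assoc a (1/ N) N ⟩
  a *ℚ (1/ N *ℚ N)    ≡⟨ cong (a *ℚ_) (ℚ.*-inverseˡ N) ⟩
  a *ℚ 1ℚ             ≡⟨ ℚ.*-identityʳ a ⟩
  a                   ∎
  where open ≡-Reasoning

÷?≤ : ∀ {a β N} → 0ℚ <ℚ N → a ≤ℚ β *ℚ N → a ÷? N ≤ℚ β
÷?≤ {a} {β} {N} 0<N a≤βN =
  ℚ.*-cancelʳ-≤-pos N {{positive 0<N}} (subst (_≤ℚ β *ℚ N) (sym (÷?-*-cancel a 0<N)) a≤βN)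

½≤÷? : ∀ {r N} → 0ℚ <ℚ N → N ≤ℚ r +ℚ r → ½ ≤ℚ r ÷? N
½≤÷? {r} {N} 0<N N≤2r = ℚ.*-cancelʳ-≤-pos N {{positive 0<N}} (begin
  ½ *ℚ N               ≡⟨ ℚ.*-comm ½ N ⟩
  N *ℚ ½               ≤⟨ ℚ.*-monoʳ-≤-nonNeg ½ N≤2r ⟩
  (r +ℚ r) *ℚ ½        ≡⟨ [p+p]*½≡p r ⟩
  r                    ≡⟨ ÷?-*-cancel r 0<N ⟨
  (r ÷? N) *ℚ N        ∎)
  where open ℚ.≤-Reasoning

maxℚ-lub : ∀ {A : Set} (g : A → ℚ) xs {c} → 0ℚ ≤ℚ c → (∀ {x} → x ∈ˡ xs → g x ≤ℚ c) → maxℚ (map g xs) ≤ℚ c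
maxℚ-lub g []       0≤c _     = 0≤c
maxℚ-lub g (x ∷ xs) 0≤c bound = ℚ.⊔-lub (bound (here refl)) (maxℚ-lub g xs 0≤c (bound ∘ there))

≤-maxℚ : ∀ {A : Set} (g : A → ℚ) {xs x} → x ∈ˡ xs → g x ≤ℚ maxℚ (map g xs)
≤-maxℚ g {y ∷ ys} (here refl) = ℚ.p≤p⊔q (g y) (maxℚ (map g ys))
≤-maxℚ g {y ∷ ys} (there x∈)  = ℚ.≤-trans (≤-maxℚ g x∈) (ℚ.p≤q⊔p (g y) (maxℚ (map g ys)))

2*p≡p+p : ∀ p → 2ℚ *ℚ p ≡ p +ℚ p
2*p≡p+p p = trans (ℚ.*-distribʳ-+ p 1ℚ 1ℚ) (cong₂ _+ℚ_ (ℚ.*-identityˡ p) (ℚ.*-identityˡ p))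

<⇒≱ : ∀ {p q} → p <ℚ q → ¬ q ≤ℚ p
<⇒≱ p<q q≤p = ℚ.<-irrefl refl (ℚ.<-≤-trans p<q q≤p)

InRange : ℚ → Set
InRange β = 0ℚ ≤ℚ β × β ≤ℚ 2ℚ

midpoint-InRange : ∀ {x y} → InRange x → InRange y → InRange ((x +ℚ y) *ℚ ½)
midpoint-InRange (0≤x , x≤2) (0≤y , y≤2) = midpoint-between 0≤x x≤2 0≤y y≤2

InRange-1 : InRange 1ℚ
InRange-1 = *≤* (+≤+ z≤n) , *≤* (+≤+ (s≤s z≤n))

InRange-2 : InRange 2ℚ
InRange-2 = *≤* (+≤+ z≤n) , ℚ.≤-refl

-- The greedy procedure G(β) and Algorithm 3

module Greedy {n} (d : Dist n) (k q : ℕ) where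

  NRq : Fin n → ℚ
  NRq = NR d k q

  ∈-keep⁻ : ∀ β s P {i} → i ∈ keep d k q β s P → i ∈ P × β *ℚ NRq i <ℚ d i s
  ∈-keep⁻ _ _ _ i∈ = let i∈P , far = Equivalence.to T-∧ (∈-tabulate⁻ i∈) in T-lookup⇒∈ i∈P , toWitness far

  keep⊆ : ∀ β s P → keep d k q β s P ⊆ P
  keep⊆ β s P = proj₁ ∘ ∈-keep⁻ β s P

  ∈-keep⁺ : ∀ β s P {i} → i ∈ P → β *ℚ NRq i <ℚ d i s → i ∈ keep d k q β s P
  ∈-keep⁺ _ _ _ i∈P far = ∈-tabulate⁺ (Equivalence.from T-∧ (∈⇒T-lookup i∈P , fromWitness far))

  GLoop-∣centres∣≤k : ∀ {β P C C′ O′} → GLoop d k q β P C C′ O′ → ∣ C ∣ ≤ k → ∣ C′ ∣ ≤ k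
  GLoop-∣centres∣≤k (stop _) ∣C∣≤k = ∣C∣≤k
  GLoop-∣centres∣≤k {C = C} (step s _ ∣C∣<k _ loop) _ =
    GLoop-∣centres∣≤k loop (ℕ.≤-trans (∣p∪⁅x⁆∣≤1+∣p∣ C s) ∣C∣<k)

  GLoop-⊆ : ∀ {β P C C′ O′} → GLoop d k q β P C C′ O′ → C ⊆ C′
  GLoop-⊆ (stop _)            = λ c∈C → c∈C
  GLoop-⊆ (step _ _ _ _ loop) = GLoop-⊆ loop ∘ x∈p∪q⁺ ∘ inj₁

  GLoop-covers : ∀ {β P C C′ O′ i} → GLoop d k q β P C C′ O′ → i ∈ P → i ∉ O′ →
                 ∃ λ c → c ∈ C′ × d i c ≤ℚ β *ℚ NRq i
  GLoop-covers (stop _) i∈P i∉P = contradiction i∈P i∉P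
  GLoop-covers {β} {P} {i = i} (step s _ _ _ loop) i∈P i∉O with i ∈? keep d k q β s P
  ... | yes i∈keep = GLoop-covers loop i∈keep i∉O
  ... | no  i∉keep = s , GLoop-⊆ loop (x∈p∪q⁺ (inj₂ (x∈⁅x⁆ s))) , ℚ.≮⇒≥ (i∉keep ∘ ∈-keep⁺ β s P i∈P)

  -- The junk value i (for empty C) never matters: GOut consults σ only off the outlier set, where C ≠ ∅.
  nearestCentre : Subset n → Fin n → Fin n
  nearestCentre C i with argmin ℚ-≤-totalOrder C (d i)
  ... | inj₁ _       = i
  ... | inj₂ (c , _) = c

  nearestCentre-spec : ∀ {C} i → Nonempty C →
                       nearestCentre C i ∈ C × ∀ h → h ∈ C → d i (nearestCentre C i) ≤ℚ d i h
  nearestCentre-spec {C} i C≠∅ with argmin ℚ-≤-totalOrder C (d i)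
  ... | inj₁ C-empty           = contradiction C≠∅ C-empty
  ... | inj₂ (c , c∈C , least) = c∈C , λ _ → least

  GOut-feasible : ∀ {β s} → GOut d k q β s → ∣ O s ∣ ≤ q → Feasible k q s
  GOut-feasible (loop , nearest) ∣O∣≤q =
    GLoop-∣centres∣≤k loop (ℕ.≤-trans (ℕ.≤-reflexive (∣⊥∣≡0 n)) z≤n) , ∣O∣≤q , λ i i∉O → proj₁ (nearest i i∉O)

  GOut-covers : ∀ {β s i} → GOut d k q β s → i ∉ O s → d i (σ s i) ≤ℚ β *ℚ NRq i
  GOut-covers {i = i} (loop , nearest) i∉O =
    let c , c∈S , close = GLoop-covers loop ∈⊤ i∉O in ℚ.≤-trans (proj₂ (nearest i i∉O) c c∈S) close

  ratio : Solution n → Fin n → ℚ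
  ratio s i = d (σ s i) i ÷? NRq i

  α-lub : ∀ {s c} → 0ℚ ≤ℚ c → (∀ {i} → i ∉ O s → ratio s i ≤ℚ c) → α d k q s ≤ℚ c
  α-lub {s} 0≤c bound =
    maxℚ-lub (ratio s) _ 0≤c (bound ∘ proj₂ ∘ ∈-filter⁻ (¬? ∘ inO? (O s)) {xs = allFin n})

  ratio≤α : ∀ {s i} → i ∉ O s → ratio s i ≤ℚ α d k q s
  ratio≤α {s} i∉O =
    ≤-maxℚ (ratio s) {filter (¬? ∘ inO? (O s)) (allFin n)} (∈-filter⁺ (¬? ∘ inO? (O s)) (∈-allFin _) i∉O)

  Certified : Solution n → Set
  Certified s = ∃ λ γ → InRange γ × GOut d k q γ s × ∣ O s ∣ ≤ q

  Alg3Loop-certified : ∀ {β₁ β₂ β cur t out} → Alg3Loop d k q β₁ β₂ β cur t out →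
                       InRange β₁ → InRange β₂ → InRange β → Certified cur → Certified out
  Alg3Loop-certified done _ _ _ cert = cert
  Alg3Loop-certified (fail _ _ _ run) _ r₂ rβ cert =
    Alg3Loop-certified run rβ r₂ (midpoint-InRange rβ r₂) cert
  Alg3Loop-certified {β = β} (succ _ out few run) r₁ _ rβ _ =
    Alg3Loop-certified run r₁ rβ (midpoint-InRange r₁ rβ) (β , rβ , out , few)

  module Metric (metric : IsMetric d) (NR>0 : ∀ i → 0ℚ <ℚ NRq i) where

    private
      d-diag : ∀ i → d i i ≡ 0ℚ
      d-diag = proj₁ (proj₂ metric)

      d-sym : ∀ i j → d i j ≡ d j i
      d-sym = proj₁ (proj₂ (proj₂ metric))

      d-triangle : ∀ h i j → d h j ≤ℚ d h i +ℚ d i j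
      d-triangle = proj₂ (proj₂ (proj₂ metric))

      NR≥0 : ∀ i → 0ℚ ≤ℚ NRq i
      NR≥0 = ℚ.<⇒≤ ∘ NR>0

    centre∉keep : ∀ {β s} P → 0ℚ ≤ℚ β → s ∉ keep d k q β s P
    centre∉keep {β} {s} P 0≤β s∈keep = <⇒≱ (proj₂ (∈-keep⁻ β s P s∈keep)) (begin
      d s s         ≡⟨ d-diag s ⟩
      0ℚ            ≡⟨ ℚ.*-zeroˡ (NRq s) ⟨
      0ℚ *ℚ NRq s   ≤⟨ ℚ.*-monoʳ-≤-nonNeg (NRq s) {{nonNegative (NR≥0 s)}} 0≤β ⟩
      β *ℚ NRq s    ∎)
      where open ℚ.≤-Reasoning

    GLoop-exists : ∀ {β} → 0ℚ ≤ℚ β → ∀ P C → ∃₂ λ C′ O′ → GLoop d k q β P C C′ O′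
    GLoop-exists {β} 0≤β P C = go P C (<-wellFounded ∣ P ∣)
      where
      go : ∀ P C → Acc _<_ ∣ P ∣ → ∃₂ λ C′ O′ → GLoop d k q β P C C′ O′
      go P C (acc smaller) with argmin ℚ-≤-totalOrder P NRq
      ... | inj₁ P-empty = C , P , stop (inj₁ P-empty)
      ... | inj₂ (s , s∈P , least) with k ℕ.≤? ∣ C ∣
      ... | yes full = C , P , stop (inj₂ full)
      ... | no room
        with go (keep d k q β s P) (C ∪ ⁅ s ⁆) (smaller (p⊂q⇒∣p∣<∣q∣ (keep⊆ β s P , s , s∈P , centre∉keep P 0≤β)))
      ... | C′ , O′ , loop = C′ , O′ , step s s∈P (ℕ.≰⇒> room) (λ _ → least) loop

    G-exists : ∀ {β} → 0ℚ ≤ℚ β → ∃ (GOut d k q β)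
    G-exists 0≤β =
      let C , O′ , loop = GLoop-exists 0≤β ⊤ ⊥
          C≠∅ : ∀ {i} → i ∉ O′ → Nonempty C
          C≠∅ i∉O′ = let c , c∈C , _ = GLoop-covers loop ∈⊤ i∉O′ in c , c∈C
      in sol C O′ (nearestCentre C) , loop , λ i i∉O′ → nearestCentre-spec i (C≠∅ i∉O′)

    α≤β : ∀ {β s} → 0ℚ ≤ℚ β → GOut d k q β s → α d k q s ≤ℚ β
    α≤β {β} {s} 0≤β out =
      α-lub {s} 0≤β λ {i} i∉O → ÷?≤ (NR>0 i) (subst (_≤ℚ β *ℚ NRq i) (d-sym i (σ s i)) (GOut-covers out i∉O))

    Alg3Loop-exists : ∀ {β₁ β₂ β} t cur → InRange β₁ → InRange β₂ → InRange β → ∃ (Alg3Loop d k q β₁ β₂ β cur t)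
    Alg3Loop-exists zero    cur _  _  _  = cur , done
    Alg3Loop-exists (suc t) cur r₁ r₂ rβ with G-exists (proj₁ rβ)
    ... | s , out with q ℕ.<? ∣ O s ∣
    ... | yes many = let final , run = Alg3Loop-exists t cur rβ r₂ (midpoint-InRange rβ r₂)
                     in final , fail s out many run
    ... | no  few  = let final , run = Alg3Loop-exists t s r₁ rβ (midpoint-InRange r₁ rβ)
                     in final , succ s out (ℕ.≮⇒≥ few) run

    module Rank (0<k : 0 < k) (q<n : q < n) where

      rank : ℕ
      rank = ⌈ (n ∸ q) / k ⌉

      private
        0<n∸q : 0 < n ∸ q
        0<n∸q = ℕ.m<n⇒0<n∸m q<n

        0<rank : 0 < rank
        0<rank = ⌈a/k⌉>0 (n ∸ q) 0<k 0<n∸q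

        rank≤n : rank ≤ n
        rank≤n = ℕ.≤-trans (⌈a/k⌉≤a (n ∸ q) 0<k 0<n∸q) (ℕ.m∸n≤m n q)

      rank≤∣ball-NR∣ : ∀ s → rank ≤ ∣ ball d s (NRq s) ∣
      rank≤∣ball-NR∣ s = m≤∣ball-nth∣ d 0<rank rank≤n

      rank≤∣ball∣⇒NR≤ : ∀ {i r} → rank ≤ ∣ ball d i r ∣ → NRq i ≤ℚ r
      rank≤∣ball∣⇒NR≤ = m≤∣ball∣⇒nth≤r d 0<rank

      Separated : Subset n → Subset n → Set
      Separated P U = ∀ {i j} → i ∈ P → j ∈ U → NRq i <ℚ d i j

      separated-step : ∀ {s P U} → (∀ i → i ∈ P → NRq s ≤ℚ NRq i) → Separated P U →
                       Separated (keep d k q 2ℚ s P) (ball d s (NRq s) ∪ U)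
      separated-step {s} {P} {U} least sep {i} {j} i∈keep j∈ with x∈p∪q⁻ _ U j∈
      ... | inj₂ j∈U    = sep (keep⊆ 2ℚ s P i∈keep) j∈U
      ... | inj₁ j∈ball = ℚ.≰⇒> λ dij≤NRi → <⇒≱ (proj₂ (∈-keep⁻ 2ℚ s P i∈keep)) (begin
        d i s               ≤⟨ d-triangle i j s ⟩
        d i j +ℚ d j s      ≤⟨ ℚ.+-mono-≤ dij≤NRi djs≤NRi ⟩
        NRq i +ℚ NRq i      ≡⟨ 2*p≡p+p (NRq i) ⟨
        2ℚ *ℚ NRq i         ∎)
        where
        open ℚ.≤-Reasoning
        djs≤NRi : d j s ≤ℚ NRq i
        djs≤NRi = begin
          d j s   ≡⟨ d-sym j s ⟩
          d s j   ≤⟨ ∈-ball⁻ d j∈ball ⟩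
          NRq s   ≤⟨ least i (keep⊆ 2ℚ s P i∈keep) ⟩
          NRq i   ∎

      -- U is the union of the balls B(s, NR s) of the centres chosen so far.
      GLoop₂-∣outliers∣≤q : ∀ {P C C′ O′} U → GLoop d k q 2ℚ P C C′ O′ →
                            ∣ C ∣ * rank ≤ ∣ U ∣ → Separated P U → ∣ O′ ∣ ≤ q
      GLoop₂-∣outliers∣≤q {P} U (stop (inj₁ P-empty)) _ _ =
        ℕ.≤-trans (ℕ.≤-reflexive (trans (cong ∣_∣ (Empty-unique P-empty)) (∣⊥∣≡0 n))) z≤n
      GLoop₂-∣outliers∣≤q {P} {C} U (stop (inj₂ full)) covered sep = begin
        ∣ P ∣         ≤⟨ ℕ.m+n≤o⇒m≤o∸n ∣ P ∣ (ℕ.≤-trans (∣p∣+∣q∣≤∣p∪q∣ P U disjoint) (∣p∣≤n (P ∪ U))) ⟩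
        n ∸ ∣ U ∣     ≤⟨ ℕ.∸-monoʳ-≤ n n∸q≤∣U∣ ⟩
        n ∸ (n ∸ q)   ≡⟨ ℕ.m∸[m∸n]≡n (ℕ.<⇒≤ q<n) ⟩
        q             ∎
        where
        open ≤-Reasoning
        disjoint : ∀ {x} → x ∈ P → x ∉ U
        disjoint {x} x∈P x∈U = <⇒≱ (sep x∈P x∈U) (subst (_≤ℚ NRq x) (sym (d-diag x)) (NR≥0 x))
        n∸q≤∣U∣ : n ∸ q ≤ ∣ U ∣
        n∸q≤∣U∣ = begin
          n ∸ q          ≤⟨ a≤k*⌈a/k⌉ (n ∸ q) 0<k ⟩
          k * rank       ≤⟨ ℕ.*-monoˡ-≤ rank full ⟩
          ∣ C ∣ * rank   ≤⟨ covered ⟩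
          ∣ U ∣          ∎
      GLoop₂-∣outliers∣≤q {P} {C} U (step s s∈P _ least loop) covered sep =
        GLoop₂-∣outliers∣≤q (ball d s (NRq s) ∪ U) loop covered′ (separated-step least sep)
        where
        open ≤-Reasoning
        covered′ : ∣ C ∪ ⁅ s ⁆ ∣ * rank ≤ ∣ ball d s (NRq s) ∪ U ∣
        covered′ = begin
          ∣ C ∪ ⁅ s ⁆ ∣ * rank                   ≤⟨ ℕ.*-monoˡ-≤ rank (∣p∪⁅x⁆∣≤1+∣p∣ C s) ⟩
          rank + ∣ C ∣ * rank                    ≤⟨ ℕ.+-mono-≤ (rank≤∣ball-NR∣ s) covered ⟩
          ∣ ball d s (NRq s) ∣ + ∣ U ∣           ≤⟨ ∣p∣+∣q∣≤∣p∪q∣ _ U (λ j∈ball j∈U → <⇒≱ (sep s∈P j∈U) (∈-ball⁻ d j∈ball)) ⟩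
          ∣ ball d s (NRq s) ∪ U ∣               ∎

      G₂-∣outliers∣≤q : ∀ {s} → GOut d k q 2ℚ s → ∣ O s ∣ ≤ q
      G₂-∣outliers∣≤q (loop , _) =
        GLoop₂-∣outliers∣≤q ⊥ loop (subst (λ c → c * rank ≤ c) (sym (∣⊥∣≡0 n)) z≤n) (λ _ j∈⊥ → contradiction j∈⊥ ∉⊥)

      crowded-centre⇒½≤α : ∀ {s′ c} K → (∀ {i} → i ∈ K → i ∉ O s′ × σ s′ i ≡ c) → rank ≤ ∣ K ∣ →
                           ½ ≤ℚ α d k q s′
      crowded-centre⇒½≤α {s′} {c} K served crowded
        with argmin (TotalOrderProperties.≥-totalOrder ℚ-≤-totalOrder) K (d c)
      ... | inj₁ K-empty =
        contradiction (subst (rank ≤_) (trans (cong ∣_∣ (Empty-unique K-empty)) (∣⊥∣≡0 n)) crowded) (ℕ.<⇒≱ 0<rank)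
      ... | inj₂ (j , j∈K , farthest) = begin
        ½                     ≤⟨ ½≤÷? (NR>0 j) (rank≤∣ball∣⇒NR≤ (ℕ.≤-trans crowded (p⊆q⇒∣p∣≤∣q∣ K⊆ball))) ⟩
        d c j ÷? NRq j        ≡⟨ cong (λ c → d c j ÷? NRq j) (proj₂ (served j∈K)) ⟨
        ratio s′ j            ≤⟨ ratio≤α {s′} (proj₁ (served j∈K)) ⟩
        α d k q s′            ∎
        where
        open ℚ.≤-Reasoning
        K⊆ball : K ⊆ ball d j (d c j +ℚ d c j)
        K⊆ball {i} i∈K = ∈-ball⁺ d (begin
          d j i              ≤⟨ d-triangle j c i ⟩
          d j c +ℚ d c i     ≤⟨ ℚ.+-mono-≤ (ℚ.≤-reflexive (d-sym j c)) (farthest i∈K) ⟩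
          d c j +ℚ d c j     ∎)

      ½≤α : ∀ {s′} → Feasible k q s′ → ½ ≤ℚ α d k q s′
      ½≤α {s′} (∣S∣≤k , ∣O∣≤q , σ∈S) =
        let c , crowded = pigeonhole-preimage (σ s′) A (S s′) (λ {j} j∈A → σ∈S j (x∈∁p⇒x∉p j∈A)) many
        in crowded-centre⇒½≤α {s′} (A ∩ preimage (σ s′) c) served (ℕ.≤-trans (ℕ.m≤n+m∸n rank 1) crowded)
        where
        A : Subset n
        A = ∁ (O s′)
        many : ∣ S s′ ∣ * (rank ∸ 1) < ∣ A ∣
        many = begin-strict
          ∣ S s′ ∣ * (rank ∸ 1)   ≤⟨ ℕ.*-monoˡ-≤ (rank ∸ 1) ∣S∣≤k ⟩
          k * (rank ∸ 1)          <⟨ k*[⌈a/k⌉∸1]<a (n ∸ q) 0<k 0<n∸q ⟩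
          n ∸ q                   ≤⟨ ℕ.∸-monoʳ-≤ n ∣O∣≤q ⟩
          n ∸ ∣ O s′ ∣            ≡⟨ ∣∁p∣≡n∸∣p∣ (O s′) ⟨
          ∣ A ∣                   ∎
          where open ≤-Reasoning
        served : ∀ {c i} → i ∈ A ∩ preimage (σ s′) c → i ∉ O s′ × σ s′ i ≡ c
        served i∈ = let i∈A , i∈pre = x∈p∩q⁻ A _ i∈ in x∈∁p⇒x∉p i∈A , ∈-preimage⁻ i∈pre

theorem8 : (n : ℕ) → 1 ≤ n → (d : Dist n) → IsMetric d →
    (k q : ℕ) → 1 ≤ k → q < n →
    (∀ i → 0ℚ <ℚ NR d k q i) →
    (l : ℕ) →
    (∃ λ out → Alg3 d k q l out) ×
    (∀ out → Alg3 d k q l out →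
      Feasible k q out ×
      (∀ s′ → Feasible k q s′ → α d k q out ≤ℚ 4ℚ *ℚ α d k q s′))
-- The hypothesis 1 ≤ n is implied by q < n.
theorem8 n _ d metric k q 0<k q<n NR>0 l = runs , correct
  where
  open Greedy d k q
  open Metric metric NR>0
  open Rank 0<k q<n

  runs : ∃ λ out → Alg3 d k q l out
  runs = let s₀ , g₀ = G-exists (proj₁ InRange-2)
             out , run = Alg3Loop-exists l s₀ InRange-1 InRange-2 InRange-1
         in out , s₀ , g₀ , run

  correct : ∀ out → Alg3 d k q l out →
            Feasible k q out × (∀ s′ → Feasible k q s′ → α d k q out ≤ℚ 4ℚ *ℚ α d k q s′)
  correct out (s₀ , g₀ , run) =
    let γ , (0≤γ , γ≤2) , g , few =
          Alg3Loop-certified run InRange-1 InRange-2 InRange-1 (2ℚ , InRange-2 , g₀ , G₂-∣outliers∣≤q g₀)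
    in GOut-feasible g few , λ s′ feasible → begin
      α d k q out        ≤⟨ α≤β 0≤γ g ⟩
      γ                  ≤⟨ γ≤2 ⟩
      2ℚ                 ≡⟨ refl ⟩
      4ℚ *ℚ ½            ≤⟨ ℚ.*-monoˡ-≤-nonNeg 4ℚ (½≤α feasible) ⟩
      4ℚ *ℚ α d k q s′   ∎
    where open ℚ.≤-Reasoning
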